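{- Let $G=(V,E)$ be a $2$-connected graph. Then a subset $S\subseteq V$ is a simultaneous dominating set of $G$ if and only if $S$ is a vertex cover of $G$.
   Context: All graphs are finite, simple and undirected. For a connected graph $G$, a subset $S\subseteq V(G)$ is a simultaneous dominating set of $G$ if $S$ is a dominating set (every vertex not in $S$ has a neighbour in $S$) in every spanning tree of $G$. A graph is $2$-connected if it has no cut vertex (a vertex whose removal increases the number of connected components). -}

module Defs where

open import Data.Nat using (ℕ; suc; _≤_; _+_)
open import Data.Fin using (Fin)
open import Data.Fin.Subset using (Subset; _∈_)
open import Data.Bool using (Bool; true; false)
open import Data.List using (List; []; _∷_; length)
open import Data.List.Relation.Unary.Unique.Propositional using (Unique)
open import Data.Product using (Σ; ∃; _×_; _,_)
open import Data.Sum using (_⊎_)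
open import Relation.Binary.PropositionalEquality using (_≡_; _≢_)
open import Relation.Nullary using (¬_)
open import Data.Unit using (⊤)

record Graph (n : ℕ) : Set where
  field
    adj   : Fin n → Fin n → Bool
    sym   : ∀ u v → adj u v ≡ adj v u
    irrefl : ∀ v → adj v v ≡ false

open Graph public

Adj : ∀ {n} → Graph n → Fin n → Fin n → Set
Adj G u v = adj G u v ≡ true

data WalkIn {n} (G : Graph n) (P : Fin n → Set) : Fin n → Fin n → Set where
  [_]  : ∀ {u} → P u → WalkIn G P u u
  _∷ʷ_ : ∀ {u v w} → (P u × Adj G u v) → WalkIn G P v w → WalkIn G P u w

Connected : ∀ {n} → Graph n → Set
Connected {n} G = ∀ (u w : Fin n) → WalkIn G (λ _ → ⊤) u w

CutVertex : ∀ {n} → Graph n → Fin n → Set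
CutVertex {n} G v =
  Σ (Fin n) λ u → Σ (Fin n) λ w →
    u ≢ v × w ≢ v × ¬ WalkIn G (λ x → x ≢ v) u w

TwoConnected : ∀ {n} → Graph n → Set
TwoConnected {n} G = 2 ≤ n × Connected G × (∀ v → ¬ CutVertex G v)

data Chain {n} (G : Graph n) : List (Fin n) → Set where
  nil  : Chain G []
  one  : ∀ {x} → Chain G (x ∷ [])
  cons : ∀ {x y xs} → Adj G x y → Chain G (y ∷ xs) → Chain G (x ∷ y ∷ xs)

last : ∀ {n} → Fin n → List (Fin n) → Fin n
last x [] = x
last x (y ∷ ys) = last y ys

Cycle : ∀ {n} → Graph n → Fin n → List (Fin n) → Set
Cycle G x xs = 3 ≤ length (x ∷ xs) × Unique (x ∷ xs) × Chain G (x ∷ xs) × Adj G (last x xs) x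

Acyclic : ∀ {n} → Graph n → Set
Acyclic {n} G = ∀ (x : Fin n) (xs : List (Fin n)) → ¬ Cycle G x xs

IsTree : ∀ {n} → Graph n → Set
IsTree G = Connected G × Acyclic G

IsSpanningTree : ∀ {n} → Graph n → Graph n → Set
IsSpanningTree {n} G T = (∀ (u v : Fin n) → Adj T u v → Adj G u v) × IsTree T

Dominating : ∀ {n} → Graph n → Subset n → Set
Dominating {n} H S = ∀ (v : Fin n) → v ∈ S ⊎ (Σ (Fin n) λ u → Adj H v u × u ∈ S)

SimultaneousDominating : ∀ {n} → Graph n → Subset n → Set
SimultaneousDominating {n} G S = ∀ (T : Graph n) → IsSpanningTree G T → Dominating T S

VertexCover : ∀ {n} → Graph n → Subset n → Set
VertexCover {n} G S = ∀ (u v : Fin n) → Adj G u v → u ∈ S ⊎ v ∈ S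

-- (⇐) A spanning tree T of a graph with at least two vertices is connected,
--     so every vertex x has a T-neighbour y; xy is an edge of G, hence x or
--     y lies in the vertex cover S, and x is dominated.
-- (⇒) Given an edge uv, we build a spanning tree in which u is a leaf whose
--     only neighbour is v; if S dominates it, then u ∈ S or v ∈ S.  As u is
--     not a cut vertex, G - u is connected; a search from v grows a parent
--     map on G - u (well-founded recursion on the explored vertex set), u is
--     attached below v, and the parent map yields the spanning tree.

module Submission where

open import Defs hiding (sym)
open import Data.Nat using (ℕ; suc; _<_; _≤_; s≤s; z≤n)
open import Data.Nat.Properties using (<-trans; <-irrefl; ≤-trans; ≤-refl; n<1+n)
open import Data.Fin using (Fin) renaming (zero to fzero; suc to fsuc)
open import Data.Fin.Properties using (_≟_; any?)
open import Data.Fin.Subset using (Subset; _∈_; _∉_; _⊃_; _∪_; ⁅_⁆)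
open import Data.Fin.Subset.Properties using (_∈?_; x∈⁅x⁆; x∈⁅y⁆⇒x≡y; p⊆p∪q; q⊆p∪q; x∈p∪q⁻)
open import Data.Fin.Subset.Induction using (⊃-wellFounded)
open import Induction.WellFounded using (Acc; acc)
open import Data.Bool using (true)
import Data.Bool.Properties as Bool
open import Data.List using (List; []; _∷_)
open import Data.List.Relation.Unary.All as All using (_∷_)
open import Data.List.Relation.Unary.Any using (here; there)
open import Data.List.Relation.Unary.AllPairs using (_∷_)
open import Data.List.Relation.Unary.Unique.Propositional using (Unique)
open import Data.List.Membership.Propositional using () renaming (_∈_ to _∈ₗ_)
open import Data.Product using (_×_; _,_; Σ; ∃; proj₁; proj₂)
open import Data.Sum using (_⊎_; inj₁; inj₂; swap; reduce)
open import Data.Empty using (⊥-elim)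
open import Data.Unit using (⊤; tt)
open import Function.Bundles using (mk⇔)
open import Relation.Unary using (Decidable)
open import Relation.Nullary using (¬_; Dec; yes; no; does)
open import Relation.Nullary.Decidable using (_×-dec_; _⊎-dec_; ¬?; dec-true; dec-false; does-⇔)
open import Relation.Binary.PropositionalEquality using (_≡_; _≢_; refl; sym; trans; subst)

does-true : ∀ {A : Set} (a? : Dec A) → does a? ≡ true → A
does-true (yes a) _ = a
does-true (no _) ()

adj⇒≢ : ∀ {n} (G : Graph n) {u v} → Adj G u v → u ≢ v
adj⇒≢ G {u} uv refl with trans (sym uv) (Graph.irrefl G u)
... | ()

adj-sym : ∀ {n} (G : Graph n) {u v} → Adj G u v → Adj G v u
adj-sym G {u} {v} uv = trans (Graph.sym G v u) uv

module _ {n} {G : Graph n} {P : Fin n → Set} where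

  walk-start : ∀ {a b} → WalkIn G P a b → P a
  walk-start [ p ] = p
  walk-start ((p , _) ∷ʷ _) = p

  _++ʷ_ : ∀ {a b c} → WalkIn G P a b → WalkIn G P b c → WalkIn G P a c
  [ _ ] ++ʷ w = w
  (s ∷ʷ w₁) ++ʷ w = s ∷ʷ (w₁ ++ʷ w)

  reverseʷ : ∀ {a b} → WalkIn G P a b → WalkIn G P b a
  reverseʷ [ p ] = [ p ]
  reverseʷ ((pa , ac) ∷ʷ w) = reverseʷ w ++ʷ ((walk-start w , adj-sym G ac) ∷ʷ [ pa ])

-- This is the data
-- a graph search produces, and it determines a tree.
record ParentMap {n} (G : Graph n) (Q : Fin n → Set) (r : Fin n) : Set where
  field
    parent   : Fin n → Fin n
    depth    : Fin n → ℕ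
    toParent : ∀ {x} → Q x → x ≢ r →
               Q (parent x) × Adj G x (parent x) × depth (parent x) < depth x

relabel : ∀ {n} {G : Graph n} {Q Q′ : Fin n → Set} {r} →
          (∀ {x} → Q′ x → Q x) → (∀ {x} → Q x → Q′ x) →
          ParentMap G Q r → ParentMap G Q′ r
relabel to from pm = record
  { parent   = parent
  ; depth    = depth
  ; toParent = λ q x≢r → let (qp , adj , lt) = toParent (to q) x≢r in from qp , adj , lt }
  where open ParentMap pm

module AttachLeaf {n} {G : Graph n} {Q : Fin n → Set} {r} (pm : ParentMap G Q r)
                  {a b} (Qa : Q a) (¬Qb : ¬ Q b) (ba : Adj G b a) where

  open ParentMap pm

  a≢b : a ≢ b
  a≢b refl = ¬Qb Qa

  parent′ : Fin n → Fin n
  parent′ x with x ≟ b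
  ... | yes _ = a
  ... | no _ = parent x

  depth′ : Fin n → ℕ
  depth′ x with x ≟ b
  ... | yes _ = suc (depth a)
  ... | no _ = depth x

  parent′-new : parent′ b ≡ a
  parent′-new with b ≟ b
  ... | yes _ = refl
  ... | no b≢b = ⊥-elim (b≢b refl)

  parent′-old : ∀ {x} → x ≢ b → parent′ x ≡ parent x
  parent′-old {x} x≢b with x ≟ b
  ... | yes x≡b = ⊥-elim (x≢b x≡b)
  ... | no _ = refl

  depth′-old : ∀ {x} → x ≢ b → depth′ x ≡ depth x
  depth′-old {x} x≢b with x ≟ b
  ... | yes x≡b = ⊥-elim (x≢b x≡b)
  ... | no _ = refl

  Q⇒≢b : ∀ {x} → Q x → x ≢ b
  Q⇒≢b qx refl = ¬Qb qx

  attached : ParentMap G (λ x → Q x ⊎ x ≡ b) r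
  attached = record { parent = parent′ ; depth = depth′ ; toParent = step }
    where
      step : ∀ {x} → Q x ⊎ x ≡ b → x ≢ r →
             (Q (parent′ x) ⊎ parent′ x ≡ b) × Adj G x (parent′ x) × depth′ (parent′ x) < depth′ x
      step {x} _ x≢r with x ≟ b
      step _ _ | yes refl
        rewrite depth′-old a≢b = inj₁ Qa , ba , n<1+n (depth a)
      step (inj₂ x≡b) _ | no x≢b = ⊥-elim (x≢b x≡b)
      step (inj₁ qx) x≢r | no _ with toParent qx x≢r
      ... | qp , adj , lt rewrite depth′-old (Q⇒≢b qp) = inj₁ qp , adj , lt

  no-child : ∀ {x} → Q x ⊎ x ≡ b → x ≢ r → parent′ x ≢ b
  no-child (inj₁ qx) x≢r rewrite parent′-old (Q⇒≢b qx) = Q⇒≢b (proj₁ (toParent qx x≢r))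
  no-child (inj₂ refl) _ rewrite parent′-new = a≢b

module ParentTree {n} (G : Graph n) (r : Fin n) (pm : ParentMap G (λ _ → ⊤) r) where

  open ParentMap pm

  ChildOf : Fin n → Fin n → Set
  ChildOf x y = x ≢ r × parent x ≡ y

  TreeEdge : Fin n → Fin n → Set
  TreeEdge x y = ChildOf x y ⊎ ChildOf y x

  treeEdge? : ∀ x y → Dec (TreeEdge x y)
  treeEdge? x y = childOf? x y ⊎-dec childOf? y x
    where childOf? : ∀ x y → Dec (ChildOf x y)
          childOf? x y = ¬? (x ≟ r) ×-dec (parent x ≟ y)

  depth-child : ∀ {x y} → ChildOf x y → depth y < depth x
  depth-child (x≢r , refl) = proj₂ (proj₂ (toParent tt x≢r))

  T : Graph n
  T = record
    { adj    = λ x y → does (treeEdge? x y)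
    ; sym    = λ x y → does-⇔ (mk⇔ swap swap) (treeEdge? x y) (treeEdge? y x)
    ; irrefl = λ x → dec-false (treeEdge? x x) (λ e → <-irrefl refl (depth-child (reduce e))) }

  edge⇒ : ∀ {x y} → Adj T x y → TreeEdge x y
  edge⇒ {x} {y} = does-true (treeEdge? x y)

  ⇒edge : ∀ {x y} → TreeEdge x y → Adj T x y
  ⇒edge {x} {y} = dec-true (treeEdge? x y)

  subgraph : ∀ x y → Adj T x y → Adj G x y
  subgraph x y h with edge⇒ {x} {y} h
  ... | inj₁ (x≢r , refl) = proj₁ (proj₂ (toParent tt x≢r))
  ... | inj₂ (y≢r , refl) = adj-sym G (proj₁ (proj₂ (toParent tt y≢r)))

  -- Following parents reaches the root; `k` bounds the number of steps.
  pathToRoot : ∀ k x → depth x < k → WalkIn T (λ _ → ⊤) x r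
  pathToRoot (suc k) x (s≤s d) with x ≟ r
  ... | yes refl = [ tt ]
  ... | no x≢r = (tt , ⇒edge (inj₁ (x≢r , refl)))
                 ∷ʷ pathToRoot k (parent x) (≤-trans (depth-child (x≢r , refl)) d)

  connected : Connected T
  connected x y = pathToRoot _ x ≤-refl ++ʷ reverseʷ (pathToRoot _ y ≤-refl)

  -- The second-to-last vertex of the list y₀ ∷ y₁ ∷ ys, and the last step
  -- of a chain, needed to look at how a cycle closes.
  penultimate : Fin n → Fin n → List (Fin n) → Fin n
  penultimate y₀ y₁ [] = y₀
  penultimate y₀ y₁ (y₂ ∷ ys) = penultimate y₁ y₂ ys

  last∈ : ∀ (y : Fin n) ys → last y ys ∈ₗ (y ∷ ys)
  last∈ y [] = here refl
  last∈ y (z ∷ zs) = there (last∈ z zs)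

  penultimate∈ : ∀ y₀ y₁ ys → penultimate y₀ y₁ ys ∈ₗ (y₀ ∷ y₁ ∷ ys)
  penultimate∈ y₀ y₁ [] = here refl
  penultimate∈ y₀ y₁ (y₂ ∷ ys) = there (penultimate∈ y₁ y₂ ys)

  lastStep : ∀ y₀ y₁ ys → Chain T (y₀ ∷ y₁ ∷ ys) → Adj T (penultimate y₀ y₁ ys) (last y₁ ys)
  lastStep y₀ y₁ [] (cons h _) = h
  lastStep y₀ y₁ (y₂ ∷ ys) (cons _ ch) = lastStep y₁ y₂ ys ch

  -- A path without repetitions that starts by stepping down to a child
  -- keeps stepping down (stepping up would return to the previous vertex),
  -- so its depth strictly increases.
  descending : ∀ y₀ y₁ ys → Unique (y₀ ∷ y₁ ∷ ys) → Chain T (y₀ ∷ y₁ ∷ ys) →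
               ChildOf y₁ y₀ → depth y₀ < depth (last y₁ ys)
  descending y₀ y₁ [] _ _ c = depth-child c
  descending y₀ y₁ (y₂ ∷ ys) ((_ ∷ y₀≢y₂ ∷ _) ∷ u) (cons _ ch@(cons h _)) c with edge⇒ h
  ... | inj₁ (_ , p₁≡y₂) = ⊥-elim (y₀≢y₂ (trans (sym (proj₂ c)) p₁≡y₂))
  ... | inj₂ c′ = <-trans (depth-child c) (descending y₁ y₂ ys u ch c′)

  -- Dually, a path without repetitions ending with a step up to a parent
  -- went up all along: it starts with a step up and loses depth.
  ascending : ∀ y₀ y₁ ys → Unique (y₀ ∷ y₁ ∷ ys) → Chain T (y₀ ∷ y₁ ∷ ys) →
              ChildOf (penultimate y₀ y₁ ys) (last y₁ ys) →
              depth (last y₁ ys) < depth y₀ × ChildOf y₀ y₁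
  ascending y₀ y₁ [] _ _ c = depth-child c , c
  ascending y₀ y₁ (y₂ ∷ ys) ((_ ∷ y₀≢y₂ ∷ _) ∷ u) (cons h ch) c
    with ascending y₁ y₂ ys u ch c | edge⇒ h
  ... | lt , _ | inj₁ c₀ = <-trans lt (depth-child c₀) , c₀
  ... | _ , (_ , p₁≡y₂) | inj₂ (_ , p₁≡y₀) = ⊥-elim (y₀≢y₂ (trans (sym p₁≡y₀) p₁≡y₂))

  -- A cycle x x₁ … xₖ would have to go down and come back up at x, or climb
  -- to the parent of x at both ends; both contradict depth or distinctness.
  acyclic : Acyclic T
  acyclic x [] (s≤s () , _)
  acyclic x (x₁ ∷ []) (s≤s (s≤s ()) , _)
  acyclic x (x₁ ∷ x₂ ∷ xs) (_ , u@(_ ∷ (x₁∉ ∷ _)) , ch@(cons h₁ _) , closing)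
    with edge⇒ closing
  ... | inj₂ c@(_ , px≡xₖ) with edge⇒ h₁
  ...   | inj₁ (_ , px≡x₁) =
          All.lookup x₁∉ (last∈ x₂ xs) (trans (sym px≡x₁) px≡xₖ)
  ...   | inj₂ c₁ = <-irrefl refl (<-trans (descending x x₁ (x₂ ∷ xs) u ch c₁) (depth-child c))
  acyclic x (x₁ ∷ x₂ ∷ xs) (_ , u@(x∉ ∷ _) , ch , _) | inj₁ cₖ@(_ , pxₖ≡x)
    with edge⇒ (lastStep x x₁ (x₂ ∷ xs) ch)
  ... | inj₁ c = <-irrefl refl (<-trans (proj₁ (ascending x x₁ (x₂ ∷ xs) u ch c)) (depth-child cₖ))
  ... | inj₂ (_ , pxₖ≡pen) =
          All.lookup x∉ (penultimate∈ x₁ x₂ xs) (trans (sym pxₖ≡x) pxₖ≡pen)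

  spanning : IsSpanningTree G T
  spanning = subgraph , connected , acyclic

-- If every vertex of the decidable set P is (classically) reachable from r
-- inside P, then P carries a parent map rooted at r.  The explored set R
-- grows along frontier edges until none is left; then R ⊇ P.
module Search {n} (G : Graph n) {P : Fin n → Set} (P? : Decidable P) (r : Fin n) (Pr : P r)
              (reach : ∀ w → P w → ¬ ¬ WalkIn G P r w) where

  record Explored (R : Subset n) : Set where
    field
      tree  : ParentMap G (_∈ R) r
      root∈ : r ∈ R
      ⊆P    : ∀ {x} → x ∈ R → P x

  open Explored

  start : Explored ⁅ r ⁆
  start = record
    { tree  = record { parent = λ x → x ; depth = λ _ → 0
                     ; toParent = λ x∈ x≢r → ⊥-elim (x≢r (x∈⁅y⁆⇒x≡y r x∈)) }
    ; root∈ = x∈⁅x⁆ r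
    ; ⊆P    = λ x∈ → subst P (sym (x∈⁅y⁆⇒x≡y r x∈)) Pr }

  Frontier : Subset n → Set
  Frontier R = ∃ λ a → ∃ λ b → (a ∈ R × b ∉ R) × (P b × Adj G a b)

  frontier? : ∀ R → Dec (Frontier R)
  frontier? R = any? λ a → any? λ b →
    ((a ∈? R) ×-dec ¬? (b ∈? R)) ×-dec (P? b ×-dec (adj G a b Bool.≟ true))

  explore : ∀ {R} → Explored R → Frontier R → Σ (Subset n) λ R′ → R′ ⊃ R × Explored R′
  explore {R} e (a , b , (a∈R , b∉R) , (Pb , ab)) =
    R ∪ ⁅ b ⁆ , (p⊆p∪q ⁅ b ⁆ , b , q⊆p∪q R ⁅ b ⁆ (x∈⁅x⁆ b) , b∉R) , record
      { tree  = relabel to from (AttachLeaf.attached (tree e) a∈R b∉R (adj-sym G ab))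
      ; root∈ = p⊆p∪q ⁅ b ⁆ (root∈ e)
      ; ⊆P    = λ x∈ → inP (to x∈) }
    where
      to : ∀ {x} → x ∈ R ∪ ⁅ b ⁆ → x ∈ R ⊎ x ≡ b
      to x∈ with x∈p∪q⁻ R ⁅ b ⁆ x∈
      ... | inj₁ x∈R = inj₁ x∈R
      ... | inj₂ x∈b = inj₂ (x∈⁅y⁆⇒x≡y b x∈b)
      from : ∀ {x} → x ∈ R ⊎ x ≡ b → x ∈ R ∪ ⁅ b ⁆
      from (inj₁ x∈R) = p⊆p∪q ⁅ b ⁆ x∈R
      from (inj₂ refl) = q⊆p∪q R ⁅ b ⁆ (x∈⁅x⁆ b)
      inP : ∀ {x} → x ∈ R ⊎ x ≡ b → P x
      inP (inj₁ x∈R) = ⊆P e x∈R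
      inP (inj₂ refl) = Pb

  closed : ∀ {R} → ¬ Frontier R → ∀ {a b} → WalkIn G P a b → a ∈ R → b ∈ R
  closed none [ _ ] a∈R = a∈R
  closed {R} none (_∷ʷ_ {v = c} (_ , ac) w) a∈R with c ∈? R
  ... | yes c∈R = closed none w c∈R
  ... | no c∉R = ⊥-elim (none (_ , c , (a∈R , c∉R) , (walk-start w , ac)))

  -- Explore until no frontier edge is left (well-founded on R growing);
  -- then R contains every vertex of P, since P is reachable from r.
  saturate : ∀ R → Acc _⊃_ R → Explored R → Σ (Subset n) λ R′ → Explored R′ × (∀ {w} → P w → w ∈ R′)
  saturate R (acc larger) e with frontier? R
  ... | yes f = let (R′ , R′⊃R , e′) = explore e f in saturate R′ (larger R′⊃R) e′
  ... | no none = R , e , covers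
    where
      covers : ∀ {w} → P w → w ∈ R
      covers {w} Pw with w ∈? R
      ... | yes w∈R = w∈R
      ... | no w∉R = ⊥-elim (reach w Pw (λ walk → w∉R (closed none walk (root∈ e))))

  searchTree : ParentMap G P r
  searchTree = let (R , e , covers) = saturate ⁅ r ⁆ (⊃-wellFounded _) start
               in relabel covers (⊆P e) (tree e)

leafSpanningTree : ∀ {n} (G : Graph n) {u v} → Adj G u v → ¬ CutVertex G u →
                   Σ (Graph n) λ T → IsSpanningTree G T × (∀ w → Adj T u w → w ≡ v)
leafSpanningTree G {u} {v} uv noCut = T , spanning , onlyNeighbour
  where
    v≢u : v ≢ u
    v≢u v≡u = adj⇒≢ G uv (sym v≡u)

    -- A parent map on G - u rooted at v, which exists as G - u is connected.
    treeMinusU : ParentMap G (_≢ u) v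
    treeMinusU = Search.searchTree G (λ x → ¬? (x ≟ u)) v v≢u
                   (λ w w≢u noWalk → noCut (v , w , v≢u , w≢u , noWalk))

    open AttachLeaf treeMinusU v≢u (λ u≢u → u≢u refl) uv

    ≢-or-≡ : ∀ x → x ≢ u ⊎ x ≡ u
    ≢-or-≡ x with x ≟ u
    ... | yes x≡u = inj₂ x≡u
    ... | no x≢u = inj₁ x≢u

    everywhere : ParentMap G (λ _ → ⊤) v
    everywhere = relabel (λ {x} _ → ≢-or-≡ x) (λ _ → tt) attached

    open ParentTree G v everywhere

    onlyNeighbour : ∀ w → Adj T u w → w ≡ v
    onlyNeighbour w h with edge⇒ {u} {w} h
    ... | inj₁ (_ , pu≡w) = trans (sym pu≡w) parent′-new
    ... | inj₂ (w≢v , pw≡u) = ⊥-elim (no-child (≢-or-≡ w) w≢v pw≡u)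

hasNeighbour : ∀ {n} (T : Graph n) → 2 ≤ n → Connected T → ∀ x → ∃ λ y → Adj T x y
hasNeighbour T two conn x = firstStep (conn x (other two x)) (≢other two x)
  where
    other : ∀ {m} → 2 ≤ m → Fin m → Fin m
    other (s≤s (s≤s z≤n)) fzero = fsuc fzero
    other (s≤s (s≤s z≤n)) (fsuc _) = fzero

    ≢other : ∀ {m} (two : 2 ≤ m) x → x ≢ other two x
    ≢other (s≤s (s≤s z≤n)) fzero ()
    ≢other (s≤s (s≤s z≤n)) (fsuc _) ()

    firstStep : ∀ {y} → WalkIn T (λ _ → ⊤) x y → x ≢ y → ∃ λ z → Adj T x z
    firstStep [ _ ] x≢x = ⊥-elim (x≢x refl)
    firstStep ((_ , xz) ∷ʷ _) _ = _ , xz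

cover⇒simultaneous : ∀ {n} (G : Graph n) → 2 ≤ n → (S : Subset n) →
                     VertexCover G S → SimultaneousDominating G S
cover⇒simultaneous G two S cover T (subgraph , connected , _) x
  with hasNeighbour T two connected x
... | y , xy with cover x y (subgraph x y xy)
...   | inj₁ x∈S = inj₁ x∈S
...   | inj₂ y∈S = inj₂ (y , xy , y∈S)

-- If S dominates every spanning tree of a graph without cut vertices, it
-- covers every edge uv: u is dominated in a tree where v is its only neighbour.
simultaneous⇒cover : ∀ {n} (G : Graph n) → (∀ v → ¬ CutVertex G v) → (S : Subset n) →
                     SimultaneousDominating G S → VertexCover G S
simultaneous⇒cover G noCut S dominates u v uv
  with leafSpanningTree G uv (noCut u)
... | T , spanning , onlyNeighbour with dominates T spanning u
...   | inj₁ u∈S = inj₁ u∈S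
...   | inj₂ (w , uw , w∈S) rewrite onlyNeighbour w uw = inj₂ w∈S

corollary3 : ∀ {n : ℕ} (G : Graph n) → TwoConnected G → (S : Subset n) →
    (SimultaneousDominating G S → VertexCover G S) × (VertexCover G S → SimultaneousDominating G S)
corollary3 G (two , _ , noCut) S =
  simultaneous⇒cover G noCut S , cover⇒simultaneous G two S
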